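{- Let $G=([d],E)$ be a finite simple graph, $\lambda=(\lambda_1,\dots,\lambda_d)\in\mathbb{Z}_{>0}^d$, and $\Lambda:=\lambda_1+\cdots+\lambda_d$. Then every coefficient of the polynomial $[\Lambda]_q!\,\widetilde{\chi}^\lambda_G(q,x)\in\mathbb{Q}(q)[x]$ is a polynomial in $q$.
   Context: $[k]_q:=\frac{1-q^k}{1-q}=1+q+\cdots+q^{k-1}$ and $[\Lambda]_q!:=[1]_q[2]_q\cdots[\Lambda]_q$. Let $\chi_G^\lambda(q,n):=\sum_{c} q^{\sum_{i}\lambda_i c(i)}$, summed over proper colorings $c:[d]\to\{1,\dots,n\}$ ($c(i)\ne c(j)$ whenever $ij\in E$). $\widetilde{\chi}^\lambda_G(q,x)$ denotes the unique polynomial in $\mathbb{Q}(q)[x]$ with $\widetilde{\chi}^\lambda_G(q,[n]_q)=\chi_G^\lambda(q,n)$ for all positive integers $n$. -}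

module Defs where

open import Data.Nat as ℕ using (ℕ; zero; suc)
open import Data.Fin using (Fin; toℕ) renaming (zero to fzero; suc to fsuc)
open import Data.Fin.Properties using (_≟_)
open import Relation.Binary.PropositionalEquality using (_≡_)
open import Data.Bool using (Bool; true; false; _∧_; not)
open import Data.List using (List; []; _∷_; map; foldr; concatMap; filterᵇ; allFin)
open import Data.Vec.Functional using (Vector)
open import Data.Rational using (ℚ; 0ℚ; 1ℚ; _+_; _*_)
open import Relation.Nullary.Decidable using (⌊_⌋)

_^ℚ_ : ℚ → ℕ → ℚ
q ^ℚ zero  = 1ℚ
q ^ℚ suc k = q * (q ^ℚ k)

sumℚ : List ℚ → ℚ
sumℚ = foldr _+_ 0ℚ

qint : ℚ → ℕ → ℚ
qint q zero    = 0ℚ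
qint q (suc k) = 1ℚ + q * qint q k

qfact : ℚ → ℕ → ℚ
qfact q zero    = 1ℚ
qfact q (suc k) = qint q (suc k) * qfact q k

allᵇ : {A : Set} → (A → Bool) → List A → Bool
allᵇ p = foldr (λ a b → p a ∧ b) true

allFuns : (d n : ℕ) → List (Fin d → Fin n)
allFuns zero    n = (λ ()) ∷ []
allFuns (suc d) n =
  concatMap (λ a → map (λ f → λ { fzero → a ; (fsuc i) → f i }) (allFuns d n)) (allFin n)

record SimpleGraph (d : ℕ) : Set where
  field
    adj       : Fin d → Fin d → Bool
    symmetric : ∀ i j → adj i j ≡ adj j i
    loopless  : ∀ i → adj i i ≡ false
open SimpleGraph public

isProper : {d n : ℕ} → SimpleGraph d → (Fin d → Fin n) → Bool
isProper {d} G c =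
  allᵇ (λ i → allᵇ (λ j → not (adj G i j) Data.Bool.∨ not ⌊ c i ≟ c j ⌋) (allFin d)) (allFin d)

-- proper colorings c : [d] → {1,…,n}  (color k+1 is represented by k : Fin n)
properColorings : {d : ℕ} → SimpleGraph d → (n : ℕ) → List (Fin d → Fin n)
properColorings {d} G n = filterᵇ (isProper G) (allFuns d n)

weight : {d n : ℕ} → (Fin d → ℕ) → (Fin d → Fin n) → ℕ
weight {d} λ' c = foldr ℕ._+_ 0 (map (λ i → λ' i ℕ.* suc (toℕ (c i))) (allFin d))

chromatic : {d : ℕ} → SimpleGraph d → (Fin d → ℕ) → ℚ → ℕ → ℚ
chromatic G λ' q n = sumℚ (map (λ c → q ^ℚ weight λ' c) (properColorings G n))

total : {d : ℕ} → (Fin d → ℕ) → ℕ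
total {d} λ' = foldr ℕ._+_ 0 (map λ' (allFin d))

-- polynomials with rational coefficients, as coefficient lists (constant term first)
Poly : Set
Poly = List ℚ

evalPoly : Poly → ℚ → ℚ
evalPoly []       x = 0ℚ
evalPoly (a ∷ as) x = a + x * evalPoly as x

-- polynomials in x whose coefficients are polynomials in q (elements of ℚ[q][x])
evalPoly2 : List Poly → ℚ → ℚ → ℚ
evalPoly2 P q x = evalPoly (map (λ c → evalPoly c q) P) x

{-# OPTIONS --safe #-}
module Submission where

open import Defs
open import Data.Nat using (ℕ; _≤_)
open import Data.Fin using (Fin)
open import Data.List using (List)
open import Data.Product using (∃)
open import Data.Rational using (ℚ; _*_)
open import Relation.Binary.PropositionalEquality using (_≡_)

open import Algebra using (CommutativeMonoid)
import Algebra.Properties.CommutativeSemigroup as CommutativeSemigroupProperties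
open import Data.Bool using (Bool; true; false; if_then_else_; not; _∧_; _∨_)
import Data.Bool.Properties as Bool
open import Data.Fin using (toℕ) renaming (zero to fzero; suc to fsuc)
open import Data.Fin.Properties using (_≟_)
open import Data.List using ([]; _∷_; map; _++_; concatMap; filterᵇ; allFin)
import Data.List.Properties as List
import Data.Nat as ℕ
open import Data.Nat using (zero; suc)
open import Data.Nat.ListAction using (sum)
import Data.Nat.Properties as ℕ
open import Data.Product using (_×_; _,_)
open import Data.Rational using (_+_; -_; _-_; 0ℚ; 1ℚ)
import Data.Rational.Properties as ℚ
open import Data.Rational.Solver using (module +-*-Solver)
open import Data.Vec.Functional as Vector using (head; tail; updateAt)
open import Function using (id; _∘_)
open import Function.Definitions using (Congruent)
open import Relation.Binary.PropositionalEquality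
  using (_≗_; refl; sym; trans; cong; cong₂; subst; ≡-≟-identity; ≢-≟-identity; module ≡-Reasoning)
open import Relation.Nullary.Decidable using (⌊_⌋; ⌊⌋-map′; yes; no)

open +-*-Solver using (solve; _:+_; _:*_; _:-_; con; _:=_)
open ≡-Reasoning

-- Graphs are handled as edge lists, with loops and parallel edges allowed, by induction on the
-- number of vertices. For an edge e from vertex 0 to vertex k, deletion–contraction gives
-- χ_G = χ_{G∖e} − χ_{G/e}, where G/e merges vertex 0 into k with weight λ₀ + λ_k, so Λ is
-- unchanged; a loop makes χ vanish. Once vertex 0 is isolated, χ_G = S_{λ₀}(n) · χ_{G−0} with
-- S_k(n) = Σ_{a=1}^n q^{ka}. Now [Λ]! = B(q) [λ₀]! [Λ−λ₀]! with B the q-binomial coefficient,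
-- a polynomial by q-Pascal, and [k]! S_k(n) = [k−1]! q^k [kn]_q, where [kn]_q is a polynomial
-- in q and [n]_q because [a + b]_q = [a]_q + q^a [b]_q and q^n = 1 + (q − 1)[n]_q.

module PolyArithmetic {A : Set} (0# : A) (_+#_ _*#_ : A → A → A) where
  infixl 6 _⊕_
  infixl 7 _⊛_

  _⊕_ : List A → List A → List A
  []      ⊕ r       = r
  (a ∷ p) ⊕ []      = a ∷ p
  (a ∷ p) ⊕ (b ∷ r) = (a +# b) ∷ (p ⊕ r)

  _⊛_ : List A → List A → List A
  []      ⊛ r = []
  (a ∷ p) ⊛ r = map (a *#_) r ⊕ (0# ∷ p ⊛ r)

module PolyEvaluation {A : Set} (0# : A) (_+#_ _*#_ : A → A → A) (⟦_⟧ : A → ℚ)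
  (⟦0#⟧ : ⟦ 0# ⟧ ≡ 0ℚ)
  (⟦+#⟧ : ∀ a b → ⟦ a +# b ⟧ ≡ ⟦ a ⟧ + ⟦ b ⟧)
  (⟦*#⟧ : ∀ a b → ⟦ a *# b ⟧ ≡ ⟦ a ⟧ * ⟦ b ⟧) where
  open PolyArithmetic 0# _+#_ _*#_

  eval : List A → ℚ → ℚ
  eval p = evalPoly (map ⟦_⟧ p)

  eval-⊕ : ∀ p r x → eval (p ⊕ r) x ≡ eval p x + eval r x
  eval-⊕ []      r       x = sym (ℚ.+-identityˡ _)
  eval-⊕ (a ∷ p) []      x = sym (ℚ.+-identityʳ _)
  eval-⊕ (a ∷ p) (b ∷ r) x = begin
    ⟦ a +# b ⟧ + x * eval (p ⊕ r) x
      ≡⟨ cong₂ (λ u v → u + x * v) (⟦+#⟧ a b) (eval-⊕ p r x) ⟩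
    (⟦ a ⟧ + ⟦ b ⟧) + x * (eval p x + eval r x)
      ≡⟨ solve 5 (λ A B X P R → (A :+ B) :+ X :* (P :+ R) := (A :+ X :* P) :+ (B :+ X :* R))
           refl ⟦ a ⟧ ⟦ b ⟧ x (eval p x) (eval r x) ⟩
    (⟦ a ⟧ + x * eval p x) + (⟦ b ⟧ + x * eval r x) ∎

  eval-scale : ∀ a p x → eval (map (a *#_) p) x ≡ ⟦ a ⟧ * eval p x
  eval-scale a []      x = sym (ℚ.*-zeroʳ ⟦ a ⟧)
  eval-scale a (b ∷ p) x = begin
    ⟦ a *# b ⟧ + x * eval (map (a *#_) p) x
      ≡⟨ cong₂ (λ u v → u + x * v) (⟦*#⟧ a b) (eval-scale a p x) ⟩
    ⟦ a ⟧ * ⟦ b ⟧ + x * (⟦ a ⟧ * eval p x)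
      ≡⟨ solve 4 (λ A B X P → A :* B :+ X :* (A :* P) := A :* (B :+ X :* P))
           refl ⟦ a ⟧ ⟦ b ⟧ x (eval p x) ⟩
    ⟦ a ⟧ * (⟦ b ⟧ + x * eval p x) ∎

  eval-⊛ : ∀ p r x → eval (p ⊛ r) x ≡ eval p x * eval r x
  eval-⊛ []      r x = sym (ℚ.*-zeroˡ (eval r x))
  eval-⊛ (a ∷ p) r x = begin
    eval (map (a *#_) r ⊕ (0# ∷ p ⊛ r)) x
      ≡⟨ eval-⊕ (map (a *#_) r) (0# ∷ p ⊛ r) x ⟩
    eval (map (a *#_) r) x + (⟦ 0# ⟧ + x * eval (p ⊛ r) x)
      ≡⟨ cong₂ (λ u v → eval (map (a *#_) r) x + (u + x * v)) ⟦0#⟧ (eval-⊛ p r x) ⟩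
    eval (map (a *#_) r) x + (0ℚ + x * (eval p x * eval r x))
      ≡⟨ cong (_+ _) (eval-scale a r x) ⟩
    ⟦ a ⟧ * eval r x + (0ℚ + x * (eval p x * eval r x))
      ≡⟨ solve 4 (λ A R X P → A :* R :+ (con 0ℚ :+ X :* (P :* R)) := (A :+ X :* P) :* R)
           refl ⟦ a ⟧ (eval r x) x (eval p x) ⟩
    (⟦ a ⟧ + x * eval p x) * eval r x ∎

module ℚ[q] = PolyArithmetic 0ℚ _+_ _*_

module ℚ[q]-evaluation = PolyEvaluation 0ℚ _+_ _*_ id refl (λ _ _ → refl) (λ _ _ → refl)

evalPoly-map-id : ∀ p x → ℚ[q]-evaluation.eval p x ≡ evalPoly p x
evalPoly-map-id p x = cong (λ p → evalPoly p x) (List.map-id p)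

evalPoly-⊕ : ∀ p r x → evalPoly (p ℚ[q].⊕ r) x ≡ evalPoly p x + evalPoly r x
evalPoly-⊕ p r x = begin
  evalPoly (p ℚ[q].⊕ r) x                              ≡⟨ evalPoly-map-id (p ℚ[q].⊕ r) x ⟨
  ℚ[q]-evaluation.eval (p ℚ[q].⊕ r) x                  ≡⟨ ℚ[q]-evaluation.eval-⊕ p r x ⟩
  ℚ[q]-evaluation.eval p x + ℚ[q]-evaluation.eval r x
    ≡⟨ cong₂ _+_ (evalPoly-map-id p x) (evalPoly-map-id r x) ⟩
  evalPoly p x + evalPoly r x                          ∎

evalPoly-⊛ : ∀ p r x → evalPoly (p ℚ[q].⊛ r) x ≡ evalPoly p x * evalPoly r x
evalPoly-⊛ p r x = begin
  evalPoly (p ℚ[q].⊛ r) x                              ≡⟨ evalPoly-map-id (p ℚ[q].⊛ r) x ⟨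
  ℚ[q]-evaluation.eval (p ℚ[q].⊛ r) x                  ≡⟨ ℚ[q]-evaluation.eval-⊛ p r x ⟩
  ℚ[q]-evaluation.eval p x * ℚ[q]-evaluation.eval r x
    ≡⟨ cong₂ _*_ (evalPoly-map-id p x) (evalPoly-map-id r x) ⟩
  evalPoly p x * evalPoly r x                          ∎

module ℚ[q][x] = PolyArithmetic [] ℚ[q]._⊕_ ℚ[q]._⊛_

-- Here eval q P x is evalPoly2 P q x by definition.
module ℚ[q][x]-evaluation (q : ℚ) = PolyEvaluation [] ℚ[q]._⊕_ ℚ[q]._⊛_ (λ c → evalPoly c q)
  refl (λ a b → evalPoly-⊕ a b q) (λ a b → evalPoly-⊛ a b q)

PolyInQ : (ℚ → ℚ) → Set
PolyInQ f = ∃ λ (c : Poly) → ∀ q → evalPoly c q ≡ f q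

PolyInQInt : (ℕ → ℚ → ℚ) → Set
PolyInQInt F = ∃ λ (P : List Poly) → ∀ n q → evalPoly2 P q (qint q n) ≡ F n q

polyInQ-const : ∀ a → PolyInQ (λ _ → a)
polyInQ-const a = a ∷ [] , λ q → solve 2 (λ A Q → A :+ Q :* con 0ℚ := A) refl a q

polyInQ-id : PolyInQ (λ q → q)
polyInQ-id = 0ℚ ∷ 1ℚ ∷ [] , λ q →
  solve 1 (λ Q → con 0ℚ :+ Q :* (con 1ℚ :+ Q :* con 0ℚ) := Q) refl q

polyInQ-+ : ∀ {f g} → PolyInQ f → PolyInQ g → PolyInQ (λ q → f q + g q)
polyInQ-+ (c , c≗f) (c′ , c′≗g) = c ℚ[q].⊕ c′ , λ q →
  trans (evalPoly-⊕ c c′ q) (cong₂ _+_ (c≗f q) (c′≗g q))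

polyInQ-* : ∀ {f g} → PolyInQ f → PolyInQ g → PolyInQ (λ q → f q * g q)
polyInQ-* (c , c≗f) (c′ , c′≗g) = c ℚ[q].⊛ c′ , λ q →
  trans (evalPoly-⊛ c c′ q) (cong₂ _*_ (c≗f q) (c′≗g q))

polyInQInt-resp : ∀ {F G} → (∀ n q → F n q ≡ G n q) → PolyInQInt F → PolyInQInt G
polyInQInt-resp F≗G (P , P≗F) = P , λ n q → trans (P≗F n q) (F≗G n q)

polyInQInt-lift : ∀ {f} → PolyInQ f → PolyInQInt (λ _ q → f q)
polyInQInt-lift (c , c≗f) = c ∷ [] , λ n q →
  trans (solve 2 (λ C X → C :+ X :* con 0ℚ := C) refl (evalPoly c q) (qint q n)) (c≗f q)

polyInQInt-qint : PolyInQInt (λ n q → qint q n)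
polyInQInt-qint = [] ∷ (1ℚ ∷ []) ∷ [] , λ n q →
  solve 2 (λ Q X → con 0ℚ :+ X :* ((con 1ℚ :+ Q :* con 0ℚ) :+ X :* con 0ℚ) := X) refl q (qint q n)

polyInQInt-+ : ∀ {F G} → PolyInQInt F → PolyInQInt G → PolyInQInt (λ n q → F n q + G n q)
polyInQInt-+ (P , P≗F) (P′ , P′≗G) = P ℚ[q][x].⊕ P′ , λ n q →
  trans (ℚ[q][x]-evaluation.eval-⊕ q P P′ (qint q n)) (cong₂ _+_ (P≗F n q) (P′≗G n q))

polyInQInt-* : ∀ {F G} → PolyInQInt F → PolyInQInt G → PolyInQInt (λ n q → F n q * G n q)
polyInQInt-* (P , P≗F) (P′ , P′≗G) = P ℚ[q][x].⊛ P′ , λ n q →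
  trans (ℚ[q][x]-evaluation.eval-⊛ q P P′ (qint q n)) (cong₂ _*_ (P≗F n q) (P′≗G n q))

polyInQInt-- : ∀ {F G} → PolyInQInt F → PolyInQInt G → PolyInQInt (λ n q → F n q - G n q)
polyInQInt-- {F} {G} F-poly G-poly = polyInQInt-resp (λ n q → cong (F n q +_) (-1*x≡-x (G n q)))
  (polyInQInt-+ F-poly (polyInQInt-* (polyInQInt-lift (polyInQ-const (- 1ℚ))) G-poly))
  where
  -1*x≡-x : ∀ x → - 1ℚ * x ≡ - x
  -1*x≡-x x = trans (sym (ℚ.neg-distribˡ-* 1ℚ x)) (cong -_ (ℚ.*-identityˡ x))

^ℚ-distribˡ-+-* : ∀ q a b → q ^ℚ (a ℕ.+ b) ≡ q ^ℚ a * q ^ℚ b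
^ℚ-distribˡ-+-* q zero    b = sym (ℚ.*-identityˡ _)
^ℚ-distribˡ-+-* q (suc a) b = trans (cong (q *_) (^ℚ-distribˡ-+-* q a b)) (sym (ℚ.*-assoc q _ _))

qint-+ : ∀ q a b → qint q (a ℕ.+ b) ≡ qint q a + q ^ℚ a * qint q b
qint-+ q zero    b = solve 1 (λ B → B := con 0ℚ :+ con 1ℚ :* B) refl (qint q b)
qint-+ q (suc a) b = begin
  1ℚ + q * qint q (a ℕ.+ b)
    ≡⟨ cong (λ v → 1ℚ + q * v) (qint-+ q a b) ⟩
  1ℚ + q * (qint q a + q ^ℚ a * qint q b)
    ≡⟨ solve 4 (λ Q A P B → con 1ℚ :+ Q :* (A :+ P :* B) := (con 1ℚ :+ Q :* A) :+ (Q :* P) :* B)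
         refl q (qint q a) (q ^ℚ a) (qint q b) ⟩
  (1ℚ + q * qint q a) + (q * q ^ℚ a) * qint q b ∎

^ℚ≡1+[q-1]*qint : ∀ q n → q ^ℚ n ≡ 1ℚ + (q - 1ℚ) * qint q n
^ℚ≡1+[q-1]*qint q zero    = solve 1 (λ Q → con 1ℚ := con 1ℚ :+ (Q :- con 1ℚ) :* con 0ℚ) refl q
^ℚ≡1+[q-1]*qint q (suc n) = begin
  q * q ^ℚ n
    ≡⟨ cong (q *_) (^ℚ≡1+[q-1]*qint q n) ⟩
  q * (1ℚ + (q - 1ℚ) * qint q n)
    ≡⟨ solve 2 (λ Q I → Q :* (con 1ℚ :+ (Q :- con 1ℚ) :* I)
                      := con 1ℚ :+ (Q :- con 1ℚ) :* (con 1ℚ :+ Q :* I))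
         refl q (qint q n) ⟩
  1ℚ + (q - 1ℚ) * (1ℚ + q * qint q n) ∎

polyInQ-^ℚ : ∀ k → PolyInQ (λ q → q ^ℚ k)
polyInQ-^ℚ zero    = polyInQ-const 1ℚ
polyInQ-^ℚ (suc k) = polyInQ-* polyInQ-id (polyInQ-^ℚ k)

polyInQ-qint : ∀ k → PolyInQ (λ q → qint q k)
polyInQ-qint zero    = polyInQ-const 0ℚ
polyInQ-qint (suc k) = polyInQ-+ (polyInQ-const 1ℚ) (polyInQ-* polyInQ-id (polyInQ-qint k))

polyInQ-qfact : ∀ k → PolyInQ (λ q → qfact q k)
polyInQ-qfact zero    = polyInQ-const 1ℚ
polyInQ-qfact (suc k) = polyInQ-* (polyInQ-qint (suc k)) (polyInQ-qfact k)

polyInQInt-^ℚ : PolyInQInt (λ n q → q ^ℚ n)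
polyInQInt-^ℚ = polyInQInt-resp (λ n q → sym (^ℚ≡1+[q-1]*qint q n))
  (polyInQInt-+ (polyInQInt-lift (polyInQ-const 1ℚ))
    (polyInQInt-* (polyInQInt-lift (polyInQ-+ polyInQ-id (polyInQ-const (- 1ℚ)))) polyInQInt-qint))

polyInQInt-qint-* : ∀ k → PolyInQInt (λ n q → qint q (k ℕ.* n))
polyInQInt-qint-* zero    = polyInQInt-lift (polyInQ-const 0ℚ)
polyInQInt-qint-* (suc k) = polyInQInt-resp (λ n q → sym (qint-+ q n (k ℕ.* n)))
  (polyInQInt-+ polyInQInt-qint (polyInQInt-* polyInQInt-^ℚ (polyInQInt-qint-* k)))

QBinomialIsPoly : ℕ → ℕ → Set
QBinomialIsPoly a b =
  ∃ λ (h : ℚ → ℚ) → PolyInQ h × (∀ q → qfact q (a ℕ.+ b) ≡ h q * (qfact q a * qfact q b))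

qbinomial-isPoly : ∀ a b → QBinomialIsPoly a b
qbinomial-isPoly zero    b    = (λ _ → 1ℚ) , polyInQ-const 1ℚ , λ q →
  sym (trans (ℚ.*-identityˡ _) (ℚ.*-identityˡ _))
qbinomial-isPoly (suc a) zero = (λ _ → 1ℚ) , polyInQ-const 1ℚ , λ q →
  trans (cong (qfact q) (ℕ.+-identityʳ (suc a))) (sym (trans (ℚ.*-identityˡ _) (ℚ.*-identityʳ _)))
qbinomial-isPoly (suc a) (suc b) = q-Pascal (qbinomial-isPoly a (suc b)) (qbinomial-isPoly (suc a) b)
  where
  q-Pascal : QBinomialIsPoly a (suc b) → QBinomialIsPoly (suc a) b → QBinomialIsPoly (suc a) (suc b)
  q-Pascal (h₁ , h₁-poly , split₁) (h₂ , h₂-poly , split₂) =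
    (λ q → h₁ q + q ^ℚ suc a * h₂ q) , polyInQ-+ h₁-poly (polyInQ-* (polyInQ-^ℚ (suc a)) h₂-poly) , split
    where
    split : ∀ q → qfact q (suc a ℕ.+ suc b)
                    ≡ (h₁ q + q ^ℚ suc a * h₂ q) * (qfact q (suc a) * qfact q (suc b))
    split q = begin
      qint q (suc a ℕ.+ suc b) * X
        ≡⟨ cong (_* X) (qint-+ q (suc a) (suc b)) ⟩
      (ia + p * ib) * X
        ≡⟨ solve 4 (λ IA P IB X → (IA :+ P :* IB) :* X := IA :* X :+ P :* IB :* X) refl ia p ib X ⟩
      ia * X + p * ib * X
        ≡⟨ cong₂ (λ u v → ia * u + p * ib * v)
                 (split₁ q) (trans (cong (qfact q) (ℕ.+-suc a b)) (split₂ q)) ⟩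
      ia * (h₁ q * (fa * (ib * fb))) + p * ib * (h₂ q * ((ia * fa) * fb))
        ≡⟨ solve 7 (λ IA P IB H₁ H₂ FA FB →
                      IA :* (H₁ :* (FA :* (IB :* FB))) :+ P :* IB :* (H₂ :* ((IA :* FA) :* FB))
                        := (H₁ :+ P :* H₂) :* ((IA :* FA) :* (IB :* FB)))
             refl ia p ib (h₁ q) (h₂ q) fa fb ⟩
      (h₁ q + p * h₂ q) * ((ia * fa) * (ib * fb)) ∎
      where
      X ia ib p fa fb : ℚ
      X  = qfact q (a ℕ.+ suc b)
      ia = qint q (suc a)
      ib = qint q (suc b)
      p  = q ^ℚ suc a
      fa = qfact q a
      fb = qfact q b

private
  variable
    A B : Set

sumMap : (A → ℚ) → List A → ℚ
sumMap f xs = sumℚ (map f xs)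

sumMap-cong : ∀ {f g : A → ℚ} → (∀ x → f x ≡ g x) → ∀ xs → sumMap f xs ≡ sumMap g xs
sumMap-cong f≗g xs = cong sumℚ (List.map-cong f≗g xs)

sumMap-zero : ∀ (xs : List A) → sumMap (λ _ → 0ℚ) xs ≡ 0ℚ
sumMap-zero []       = refl
sumMap-zero (x ∷ xs) = trans (ℚ.+-identityˡ _) (sumMap-zero xs)

sumMap-+ : ∀ (f g : A → ℚ) xs → sumMap (λ x → f x + g x) xs ≡ sumMap f xs + sumMap g xs
sumMap-+ f g []       = refl
sumMap-+ f g (x ∷ xs) = trans (cong (f x + g x +_) (sumMap-+ f g xs))
  (solve 4 (λ A B C D → (A :+ B) :+ (C :+ D) := (A :+ C) :+ (B :+ D)) refl (f x) (g x) (sumMap f xs) (sumMap g xs))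

sumMap-- : ∀ (f g : A → ℚ) xs → sumMap (λ x → f x - g x) xs ≡ sumMap f xs - sumMap g xs
sumMap-- f g []       = refl
sumMap-- f g (x ∷ xs) = trans (cong (f x - g x +_) (sumMap-- f g xs))
  (solve 4 (λ A B C D → (A :- B) :+ (C :- D) := (A :+ C) :- (B :+ D)) refl (f x) (g x) (sumMap f xs) (sumMap g xs))

*-sumMap : ∀ c (f : A → ℚ) xs → c * sumMap f xs ≡ sumMap (λ x → c * f x) xs
*-sumMap c f []       = ℚ.*-zeroʳ c
*-sumMap c f (x ∷ xs) = trans (ℚ.*-distribˡ-+ c (f x) _) (cong (c * f x +_) (*-sumMap c f xs))

sumMap-* : ∀ (f : A → ℚ) c xs → sumMap f xs * c ≡ sumMap (λ x → f x * c) xs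
sumMap-* f c xs = begin
  sumMap f xs * c            ≡⟨ ℚ.*-comm (sumMap f xs) c ⟩
  c * sumMap f xs            ≡⟨ *-sumMap c f xs ⟩
  sumMap (λ x → c * f x) xs  ≡⟨ sumMap-cong (λ x → ℚ.*-comm c (f x)) xs ⟩
  sumMap (λ x → f x * c) xs  ∎

sumMap-++ : ∀ (f : A → ℚ) xs ys → sumMap f (xs ++ ys) ≡ sumMap f xs + sumMap f ys
sumMap-++ f []       ys = sym (ℚ.+-identityˡ _)
sumMap-++ f (x ∷ xs) ys = trans (cong (f x +_) (sumMap-++ f xs ys)) (sym (ℚ.+-assoc (f x) _ _))

sumMap-filterᵇ : ∀ (p : A → Bool) (f : A → ℚ) xs →
  sumMap f (filterᵇ p xs) ≡ sumMap (λ x → if p x then f x else 0ℚ) xs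
sumMap-filterᵇ p f []       = refl
sumMap-filterᵇ p f (x ∷ xs) with p x
... | true  = cong (f x +_) (sumMap-filterᵇ p f xs)
... | false = trans (sumMap-filterᵇ p f xs) (sym (ℚ.+-identityˡ _))

sumMap-map : ∀ (f : B → ℚ) (g : A → B) xs → sumMap f (map g xs) ≡ sumMap (f ∘ g) xs
sumMap-map f g xs = cong sumℚ (sym (List.map-∘ xs))

sumMap-concatMap : ∀ (f : B → ℚ) (g : A → List B) xs →
  sumMap f (concatMap g xs) ≡ sumMap (λ x → sumMap f (g x)) xs
sumMap-concatMap f g []       = refl
sumMap-concatMap f g (x ∷ xs) =
  trans (sumMap-++ f (g x) (concatMap g xs)) (cong (sumMap f (g x) +_) (sumMap-concatMap f g xs))

sumMap-comm : ∀ (f : A → B → ℚ) xs ys →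
  sumMap (λ x → sumMap (f x) ys) xs ≡ sumMap (λ y → sumMap (λ x → f x y) xs) ys
sumMap-comm f []       ys = sym (sumMap-zero ys)
sumMap-comm f (x ∷ xs) ys = trans (cong (sumMap (f x) ys +_) (sumMap-comm f xs ys))
  (sym (sumMap-+ (f x) (λ y → sumMap (λ x → f x y) xs) ys))

map-allFin-suc : ∀ {n} (f : Fin (suc n) → A) → map f (allFin (suc n)) ≡ f fzero ∷ map (f ∘ fsuc) (allFin n)
map-allFin-suc f =
  cong (f fzero ∷_) (trans (List.map-tabulate fsuc f) (sym (List.map-tabulate id (f ∘ fsuc))))

sumMap-allFin-suc : ∀ {n} (f : Fin (suc n) → ℚ) →
  sumMap f (allFin (suc n)) ≡ f fzero + sumMap (f ∘ fsuc) (allFin n)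
sumMap-allFin-suc f = cong sumℚ (map-allFin-suc f)

sumMap-allFin-δ : ∀ {n} (b : Fin n) (f : Fin n → ℚ) →
  sumMap (λ a → if ⌊ a ≟ b ⌋ then f a else 0ℚ) (allFin n) ≡ f b
sumMap-allFin-δ {suc n} fzero f = begin
  sumMap (λ a → if ⌊ a ≟ fzero ⌋ then f a else 0ℚ) (allFin (suc n))
    ≡⟨ sumMap-allFin-suc (λ a → if ⌊ a ≟ fzero ⌋ then f a else 0ℚ) ⟩
  f fzero + sumMap (λ _ → 0ℚ) (allFin n)
    ≡⟨ cong (f fzero +_) (sumMap-zero (allFin n)) ⟩
  f fzero + 0ℚ
    ≡⟨ ℚ.+-identityʳ (f fzero) ⟩
  f fzero ∎
sumMap-allFin-δ {suc n} (fsuc b) f = begin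
  sumMap (λ a → if ⌊ a ≟ fsuc b ⌋ then f a else 0ℚ) (allFin (suc n))
    ≡⟨ sumMap-allFin-suc (λ a → if ⌊ a ≟ fsuc b ⌋ then f a else 0ℚ) ⟩
  0ℚ + sumMap (λ a → if ⌊ fsuc a ≟ fsuc b ⌋ then f (fsuc a) else 0ℚ) (allFin n)
    ≡⟨ ℚ.+-identityˡ _ ⟩
  sumMap (λ a → if ⌊ fsuc a ≟ fsuc b ⌋ then f (fsuc a) else 0ℚ) (allFin n)
    ≡⟨ sumMap-cong (λ a → cong (if_then f (fsuc a) else 0ℚ) (⌊⌋-map′ _ _ (a ≟ b))) (allFin n) ⟩
  sumMap (λ a → if ⌊ a ≟ b ⌋ then f (fsuc a) else 0ℚ) (allFin n)
    ≡⟨ sumMap-allFin-δ b (f ∘ fsuc) ⟩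
  f (fsuc b) ∎

powerSum : ℕ → ℚ → ℕ → ℚ
powerSum k q n = sumMap (λ a → q ^ℚ (k ℕ.* suc (toℕ a))) (allFin n)

powerSum-suc : ∀ k q n → powerSum k q (suc n) ≡ q ^ℚ k * (1ℚ + powerSum k q n)
powerSum-suc k q n = begin
  powerSum k q (suc n)
    ≡⟨ sumMap-allFin-suc {n} (λ a → q ^ℚ (k ℕ.* suc (toℕ a))) ⟩
  q ^ℚ (k ℕ.* 1) + sumMap (λ a → q ^ℚ (k ℕ.* suc (suc (toℕ a)))) (allFin n)
    ≡⟨ cong₂ _+_ (cong (q ^ℚ_) (ℕ.*-identityʳ k))
                 (sumMap-cong (λ a → trans (cong (q ^ℚ_) (ℕ.*-suc k _)) (^ℚ-distribˡ-+-* q k _))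
                              (allFin n)) ⟩
  q ^ℚ k + sumMap (λ a → q ^ℚ k * q ^ℚ (k ℕ.* suc (toℕ a))) (allFin n)
    ≡⟨ cong (q ^ℚ k +_) (*-sumMap (q ^ℚ k) _ (allFin n)) ⟨
  q ^ℚ k + q ^ℚ k * powerSum k q n
    ≡⟨ solve 2 (λ P S → P :+ P :* S := P :* (con 1ℚ :+ S)) refl (q ^ℚ k) (powerSum k q n) ⟩
  q ^ℚ k * (1ℚ + powerSum k q n) ∎

qint*powerSum : ∀ k q n → qint q k * powerSum k q n ≡ q ^ℚ k * qint q (k ℕ.* n)
qint*powerSum k q zero    = begin
  qint q k * 0ℚ              ≡⟨ ℚ.*-zeroʳ (qint q k) ⟩
  0ℚ                         ≡⟨ ℚ.*-zeroʳ (q ^ℚ k) ⟨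
  q ^ℚ k * qint q 0          ≡⟨ cong (λ m → q ^ℚ k * qint q m) (ℕ.*-zeroʳ k) ⟨
  q ^ℚ k * qint q (k ℕ.* 0)  ∎
qint*powerSum k q (suc n) = begin
  qint q k * powerSum k q (suc n)
    ≡⟨ cong (qint q k *_) (powerSum-suc k q n) ⟩
  qint q k * (q ^ℚ k * (1ℚ + powerSum k q n))
    ≡⟨ solve 3 (λ I P S → I :* (P :* (con 1ℚ :+ S)) := P :* (I :+ I :* S))
         refl (qint q k) (q ^ℚ k) (powerSum k q n) ⟩
  q ^ℚ k * (qint q k + qint q k * powerSum k q n)
    ≡⟨ cong (λ v → q ^ℚ k * (qint q k + v)) (qint*powerSum k q n) ⟩
  q ^ℚ k * (qint q k + q ^ℚ k * qint q (k ℕ.* n))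
    ≡⟨ cong (q ^ℚ k *_) (qint-+ q k (k ℕ.* n)) ⟨
  q ^ℚ k * qint q (k ℕ.+ k ℕ.* n)
    ≡⟨ cong (λ m → q ^ℚ k * qint q m) (ℕ.*-suc k n) ⟨
  q ^ℚ k * qint q (k ℕ.* suc n) ∎

-- For k = 0 the factor is n itself, which is not a polynomial in q and [n]_q.
polyInQInt-qfact*powerSum : ∀ k → 1 ≤ k → PolyInQInt (λ n q → qfact q k * powerSum k q n)
polyInQInt-qfact*powerSum (suc k) _ = polyInQInt-resp factor
  (polyInQInt-* (polyInQInt-lift (polyInQ-qfact k))
    (polyInQInt-* (polyInQInt-lift (polyInQ-^ℚ (suc k))) (polyInQInt-qint-* (suc k))))
  where
  factor : ∀ n q → qfact q k * (q ^ℚ suc k * qint q (suc k ℕ.* n)) ≡ qfact q (suc k) * powerSum (suc k) q n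
  factor n q = begin
    qfact q k * (q ^ℚ suc k * qint q (suc k ℕ.* n))
      ≡⟨ cong (qfact q k *_) (qint*powerSum (suc k) q n) ⟨
    qfact q k * (qint q (suc k) * powerSum (suc k) q n)
      ≡⟨ solve 3 (λ F I S → F :* (I :* S) := (I :* F) :* S)
           refl (qfact q k) (qint q (suc k)) (powerSum (suc k) q n) ⟩
    qfact q (suc k) * powerSum (suc k) q n ∎

module ℕ+ = CommutativeSemigroupProperties ℕ.+-commutativeSemigroup
module Bool∧ = CommutativeSemigroupProperties (CommutativeMonoid.commutativeSemigroup Bool.∧-commutativeMonoid)

Positive : ∀ {d} → (Fin d → ℕ) → Set
Positive w = ∀ i → 1 ≤ w i

sum-allFin-suc : ∀ {d} (f : Fin (suc d) → ℕ) →
  sum (map f (allFin (suc d))) ≡ f fzero ℕ.+ sum (map (f ∘ fsuc) (allFin d))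
sum-allFin-suc f = cong sum (map-allFin-suc f)

sum-updateAt : ∀ {d} (g t : Fin d → ℕ) k c →
  sum (map (λ i → updateAt g k (c ℕ.+_) i ℕ.* t i) (allFin d))
    ≡ c ℕ.* t k ℕ.+ sum (map (λ i → g i ℕ.* t i) (allFin d))
sum-updateAt {suc d} g t fzero c = begin
  sum (map (λ i → updateAt g fzero (c ℕ.+_) i ℕ.* t i) (allFin (suc d)))
    ≡⟨ sum-allFin-suc (λ i → updateAt g fzero (c ℕ.+_) i ℕ.* t i) ⟩
  (c ℕ.+ g fzero) ℕ.* t fzero ℕ.+ S
    ≡⟨ cong (ℕ._+ S) (ℕ.*-distribʳ-+ (t fzero) c (g fzero)) ⟩
  c ℕ.* t fzero ℕ.+ g fzero ℕ.* t fzero ℕ.+ S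
    ≡⟨ ℕ.+-assoc (c ℕ.* t fzero) _ S ⟩
  c ℕ.* t fzero ℕ.+ (g fzero ℕ.* t fzero ℕ.+ S)
    ≡⟨ cong (c ℕ.* t fzero ℕ.+_) (sum-allFin-suc (λ i → g i ℕ.* t i)) ⟨
  c ℕ.* t fzero ℕ.+ sum (map (λ i → g i ℕ.* t i) (allFin (suc d))) ∎
  where
  S : ℕ
  S = sum (map (λ i → g (fsuc i) ℕ.* t (fsuc i)) (allFin d))
sum-updateAt {suc d} g t (fsuc k) c = begin
  sum (map (λ i → updateAt g (fsuc k) (c ℕ.+_) i ℕ.* t i) (allFin (suc d)))
    ≡⟨ sum-allFin-suc (λ i → updateAt g (fsuc k) (c ℕ.+_) i ℕ.* t i) ⟩
  g fzero ℕ.* t fzero ℕ.+ sum (map (λ i → updateAt (tail g) k (c ℕ.+_) i ℕ.* t (fsuc i)) (allFin d))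
    ≡⟨ cong (g fzero ℕ.* t fzero ℕ.+_) (sum-updateAt (tail g) (tail t) k c) ⟩
  g fzero ℕ.* t fzero ℕ.+ (c ℕ.* t (fsuc k) ℕ.+ S)
    ≡⟨ ℕ+.x∙yz≈y∙xz (g fzero ℕ.* t fzero) (c ℕ.* t (fsuc k)) S ⟩
  c ℕ.* t (fsuc k) ℕ.+ (g fzero ℕ.* t fzero ℕ.+ S)
    ≡⟨ cong (c ℕ.* t (fsuc k) ℕ.+_) (sum-allFin-suc (λ i → g i ℕ.* t i)) ⟨
  c ℕ.* t (fsuc k) ℕ.+ sum (map (λ i → g i ℕ.* t i) (allFin (suc d))) ∎
  where
  S : ℕ
  S = sum (map (λ i → g (fsuc i) ℕ.* t (fsuc i)) (allFin d))

≤-updateAt-+ : ∀ {d} (g : Fin d → ℕ) k c i → g i ≤ updateAt g k (c ℕ.+_) i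
≤-updateAt-+ g fzero    c fzero    = ℕ.m≤n+m (g fzero) c
≤-updateAt-+ g fzero    c (fsuc i) = ℕ.≤-refl
≤-updateAt-+ g (fsuc k) c fzero    = ℕ.≤-refl
≤-updateAt-+ g (fsuc k) c (fsuc i) = ≤-updateAt-+ (tail g) k c i

contractWeight : ∀ {d} → (Fin (suc d) → ℕ) → Fin d → Fin d → ℕ
contractWeight w k = updateAt (tail w) k (head w ℕ.+_)

contractWeight-positive : ∀ {d} (w : Fin (suc d) → ℕ) k → Positive w → Positive (contractWeight w k)
contractWeight-positive w k w-pos i = ℕ.≤-trans (w-pos (fsuc i)) (≤-updateAt-+ (tail w) k (head w) i)

total-contractWeight : ∀ {d} (w : Fin (suc d) → ℕ) k → total (contractWeight w k) ≡ total w
total-contractWeight {d} w k = begin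
  total (contractWeight w k)
    ≡⟨ cong sum (List.map-cong (λ i → ℕ.*-identityʳ (contractWeight w k i)) (allFin d)) ⟨
  sum (map (λ i → contractWeight w k i ℕ.* 1) (allFin d))
    ≡⟨ sum-updateAt (tail w) (λ _ → 1) k (head w) ⟩
  head w ℕ.* 1 ℕ.+ sum (map (λ i → tail w i ℕ.* 1) (allFin d))
    ≡⟨ cong₂ ℕ._+_ (ℕ.*-identityʳ (head w))
                   (cong sum (List.map-cong (λ i → ℕ.*-identityʳ (tail w i)) (allFin d))) ⟩
  head w ℕ.+ total (tail w)
    ≡⟨ sum-allFin-suc w ⟨
  total w ∎

weight-∷ : ∀ {d n} (w : Fin (suc d) → ℕ) (a : Fin n) f →
  weight w (a Vector.∷ f) ≡ head w ℕ.* suc (toℕ a) ℕ.+ weight (tail w) f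
weight-∷ w a f = sum-allFin-suc (λ i → w i ℕ.* suc (toℕ ((a Vector.∷ f) i)))

weight-contract : ∀ {d n} (w : Fin (suc d) → ℕ) k (f : Fin d → Fin n) →
  weight w (f k Vector.∷ f) ≡ weight (contractWeight w k) f
weight-contract w k f =
  trans (weight-∷ w (f k) f) (sym (sum-updateAt (tail w) (λ i → suc (toℕ (f i))) k (head w)))

weight-cong : ∀ {d n} (w : Fin d → ℕ) {c c′ : Fin d → Fin n} → c ≗ c′ → weight w c ≡ weight w c′
weight-cong {d} w c≗c′ =
  cong sum (List.map-cong (λ i → cong (λ x → w i ℕ.* suc (toℕ x)) (c≗c′ i)) (allFin d))

Edge : ℕ → Set
Edge d = Fin d × Fin d

mapEdge : ∀ {d d′} → (Fin d → Fin d′) → Edge d → Edge d′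
mapEdge f (u , v) = f u , f v

contractVertex : ∀ {d} → Fin d → Fin (suc d) → Fin d
contractVertex k = k Vector.∷ id

separates : ∀ {d n} → (Fin d → Fin n) → Edge d → Bool
separates c (u , v) = not ⌊ c u ≟ c v ⌋

isProperFor : ∀ {d n} → List (Edge d) → (Fin d → Fin n) → Bool
isProperFor es c = allᵇ (separates c) es

allᵇ-++ : ∀ (p : A → Bool) xs ys → allᵇ p (xs ++ ys) ≡ allᵇ p xs ∧ allᵇ p ys
allᵇ-++ p []       ys = refl
allᵇ-++ p (x ∷ xs) ys = trans (cong (p x ∧_) (allᵇ-++ p xs ys)) (sym (Bool.∧-assoc (p x) _ _))

allᵇ-concatMap : ∀ (p : B → Bool) (f : A → List B) xs →
  allᵇ p (concatMap f xs) ≡ allᵇ (λ x → allᵇ p (f x)) xs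
allᵇ-concatMap p f []       = refl
allᵇ-concatMap p f (x ∷ xs) =
  trans (allᵇ-++ p (f x) (concatMap f xs)) (cong (allᵇ p (f x) ∧_) (allᵇ-concatMap p f xs))

allᵇ-cong : ∀ {p p′ : A → Bool} → (∀ x → p x ≡ p′ x) → ∀ xs → allᵇ p xs ≡ allᵇ p′ xs
allᵇ-cong p≗p′ = List.foldr-cong (λ x b → cong (_∧ b) (p≗p′ x)) refl

isProperFor-map : ∀ {d d′ n} (f : Fin d → Fin d′) es (c : Fin d′ → Fin n) →
  isProperFor (map (mapEdge f) es) c ≡ isProperFor es (c ∘ f)
isProperFor-map f es c = List.foldr-map _ (mapEdge f) true es

isProperFor-cong : ∀ {d n} es {c c′ : Fin d → Fin n} → c ≗ c′ → isProperFor es c ≡ isProperFor es c′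
isProperFor-cong []             c≗c′ = refl
isProperFor-cong ((u , v) ∷ es) c≗c′ =
  cong₂ _∧_ (cong₂ (λ x y → not ⌊ x ≟ y ⌋) (c≗c′ u) (c≗c′ v)) (isProperFor-cong es c≗c′)

⌊≟⌋-refl : ∀ {n} (x : Fin n) → ⌊ x ≟ x ⌋ ≡ true
⌊≟⌋-refl x = cong ⌊_⌋ (≡-≟-identity _≟_ refl)

⌊≟⌋-sym : ∀ {n} (x y : Fin n) → ⌊ x ≟ y ⌋ ≡ ⌊ y ≟ x ⌋
⌊≟⌋-sym x y with x ≟ y
... | yes refl = sym (⌊≟⌋-refl x)
... | no x≢y   = cong ⌊_⌋ (sym (≢-≟-identity _≟_ (x≢y ∘ sym)))

isProperFor-swap : ∀ {d n} (u v : Fin d) es (c : Fin d → Fin n) →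
  isProperFor ((v , u) ∷ es) c ≡ isProperFor ((u , v) ∷ es) c
isProperFor-swap u v es c = cong (λ b → not b ∧ isProperFor es c) (⌊≟⌋-sym (c v) (c u))

isProperFor-move : ∀ {d n} e (es es′ : List (Edge d)) (c : Fin d → Fin n) →
  isProperFor (e ∷ es ++ es′) c ≡ isProperFor (es ++ e ∷ es′) c
isProperFor-move e es es′ c = begin
  separates c e ∧ isProperFor (es ++ es′) c
    ≡⟨ cong (separates c e ∧_) (allᵇ-++ (separates c) es es′) ⟩
  separates c e ∧ (isProperFor es c ∧ isProperFor es′ c)
    ≡⟨ Bool∧.x∙yz≈y∙xz (separates c e) (isProperFor es c) (isProperFor es′ c) ⟩
  isProperFor es c ∧ (separates c e ∧ isProperFor es′ c)
    ≡⟨ allᵇ-++ (separates c) es (e ∷ es′) ⟨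
  isProperFor (es ++ e ∷ es′) c ∎

chromaticTerm : ∀ {d n} → List (Edge d) → (Fin d → ℕ) → ℚ → (Fin d → Fin n) → ℚ
chromaticTerm es w q c = if isProperFor es c then q ^ℚ weight w c else 0ℚ

chromaticᴱ : ∀ {d} → List (Edge d) → (Fin d → ℕ) → ℚ → ℕ → ℚ
chromaticᴱ {d} es w q n = sumMap (chromaticTerm es w q) (allFuns d n)

chromaticTerm-cong : ∀ {d n} es (w : Fin d → ℕ) q → Congruent _≗_ _≡_ (chromaticTerm {n = n} es w q)
chromaticTerm-cong es w q c≗c′ =
  cong₂ (λ b k → if b then q ^ℚ k else 0ℚ) (isProperFor-cong es c≗c′) (weight-cong w c≗c′)

chromaticᴱ-cong : ∀ {d} (es es′ : List (Edge d)) →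
  (∀ {n} (c : Fin d → Fin n) → isProperFor es c ≡ isProperFor es′ c) →
  ∀ w q n → chromaticᴱ es w q n ≡ chromaticᴱ es′ w q n
chromaticᴱ-cong {d} es es′ same w q n =
  sumMap-cong (λ c → cong (λ b → if b then q ^ℚ weight w c else 0ℚ) (same c)) (allFuns d n)

-- allFuns builds its colourings with a pattern lambda, which agrees with Vector._∷_ only pointwise.
sumMap-allFuns-suc : ∀ {d n} (h : (Fin (suc d) → Fin n) → ℚ) → Congruent _≗_ _≡_ h →
  sumMap h (allFuns (suc d) n) ≡ sumMap (λ a → sumMap (λ f → h (a Vector.∷ f)) (allFuns d n)) (allFin n)
sumMap-allFuns-suc {d} {n} h h-cong = trans (sumMap-concatMap h _ (allFin n))
  (sumMap-cong (λ a → trans (sumMap-map h _ (allFuns d n))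
    (sumMap-cong (λ f → h-cong (λ { fzero → refl ; (fsuc i) → refl })) (allFuns d n))) (allFin n))

chromaticᴱ-loop : ∀ {d} (u : Fin d) es w q n → chromaticᴱ ((u , u) ∷ es) w q n ≡ 0ℚ
chromaticᴱ-loop {d} u es w q n = trans
  (sumMap-cong (λ c → cong (λ b → if not b ∧ isProperFor es c then q ^ℚ weight w c else 0ℚ)
                           (⌊≟⌋-refl (c u)))
               (allFuns d n))
  (sumMap-zero (allFuns d n))

chromaticᴱ-identified : ∀ {d} → Edge d → List (Edge d) → (Fin d → ℕ) → ℚ → ℕ → ℚ
chromaticᴱ-identified {d} (u , v) es w q n =
  sumMap (λ c → if ⌊ c u ≟ c v ⌋ then chromaticTerm es w q c else 0ℚ) (allFuns d n)

chromaticᴱ-delete : ∀ {d} e (es : List (Edge d)) w q n →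
  chromaticᴱ (e ∷ es) w q n ≡ chromaticᴱ es w q n - chromaticᴱ-identified e es w q n
chromaticᴱ-delete {d} (u , v) es w q n = trans
  (sumMap-cong (λ c → indicator-split ⌊ c u ≟ c v ⌋ (isProperFor es c) (q ^ℚ weight w c)) (allFuns d n))
  (sumMap-- _ _ (allFuns d n))
  where
  indicator-split : ∀ b p t →
    (if not b ∧ p then t else 0ℚ) ≡ (if p then t else 0ℚ) - (if b then (if p then t else 0ℚ) else 0ℚ)
  indicator-split true  p t = sym (ℚ.+-inverseʳ (if p then t else 0ℚ))
  indicator-split false p t = sym (ℚ.+-identityʳ (if p then t else 0ℚ))

chromaticᴱ-identified-contract : ∀ {d} (k : Fin d) es w q n →
  chromaticᴱ-identified (fzero , fsuc k) es w q n
    ≡ chromaticᴱ (map (mapEdge (contractVertex k)) es) (contractWeight w k) q n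
chromaticᴱ-identified-contract {d} k es w q n = begin
  chromaticᴱ-identified (fzero , fsuc k) es w q n
    ≡⟨ sumMap-allFuns-suc identified identified-cong ⟩
  sumMap (λ a → sumMap (λ f → if ⌊ a ≟ f k ⌋ then term (a Vector.∷ f) else 0ℚ) (allFuns d n)) (allFin n)
    ≡⟨ sumMap-comm (λ a f → if ⌊ a ≟ f k ⌋ then term (a Vector.∷ f) else 0ℚ)
                   (allFin n) (allFuns d n) ⟩
  sumMap (λ f → sumMap (λ a → if ⌊ a ≟ f k ⌋ then term (a Vector.∷ f) else 0ℚ) (allFin n)) (allFuns d n)
    ≡⟨ sumMap-cong (λ f → sumMap-allFin-δ (f k) (λ a → term (a Vector.∷ f))) (allFuns d n) ⟩
  sumMap (λ f → term (f k Vector.∷ f)) (allFuns d n)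
    ≡⟨ sumMap-cong term-contract (allFuns d n) ⟩
  chromaticᴱ (map (mapEdge (contractVertex k)) es) (contractWeight w k) q n ∎
  where
  term : (Fin (suc d) → Fin n) → ℚ
  term = chromaticTerm es w q

  identified : (Fin (suc d) → Fin n) → ℚ
  identified c = if ⌊ c fzero ≟ c (fsuc k) ⌋ then term c else 0ℚ

  identified-cong : Congruent _≗_ _≡_ identified
  identified-cong c≗c′ = cong₂ (λ b t → if b then t else 0ℚ)
    (cong₂ (λ x y → ⌊ x ≟ y ⌋) (c≗c′ fzero) (c≗c′ (fsuc k))) (chromaticTerm-cong es w q c≗c′)

  term-contract : ∀ f →
    term (f k Vector.∷ f) ≡ chromaticTerm (map (mapEdge (contractVertex k)) es) (contractWeight w k) q f
  term-contract f = cong₂ (λ b m → if b then q ^ℚ m else 0ℚ)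
    (trans (isProperFor-cong es (λ { fzero → refl ; (fsuc i) → refl }))
           (sym (isProperFor-map (contractVertex k) es f)))
    (weight-contract w k f)

chromaticᴱ-deletion-contraction : ∀ {d} (k : Fin d) es w q n →
  chromaticᴱ ((fzero , fsuc k) ∷ es) w q n
    ≡ chromaticᴱ es w q n - chromaticᴱ (map (mapEdge (contractVertex k)) es) (contractWeight w k) q n
chromaticᴱ-deletion-contraction k es w q n = trans (chromaticᴱ-delete (fzero , fsuc k) es w q n)
  (cong (λ x → chromaticᴱ es w q n - x) (chromaticᴱ-identified-contract k es w q n))

chromaticᴱ-isolated : ∀ {d} (es : List (Edge d)) w q n →
  chromaticᴱ (map (mapEdge fsuc) es) w q n ≡ powerSum (head w) q n * chromaticᴱ es (tail w) q n
chromaticᴱ-isolated {d} es w q n = begin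
  chromaticᴱ (map (mapEdge fsuc) es) w q n
    ≡⟨ sumMap-allFuns-suc {d} {n} (chromaticTerm (map (mapEdge fsuc) es) w q)
                                  (chromaticTerm-cong (map (mapEdge fsuc) es) w q) ⟩
  sumMap (λ a → sumMap (λ f → chromaticTerm (map (mapEdge fsuc) es) w q (a Vector.∷ f)) (allFuns d n)) (allFin n)
    ≡⟨ sumMap-cong (λ a → sumMap-cong (term-split a) (allFuns d n)) (allFin n) ⟩
  sumMap (λ a → sumMap (λ f → vertex0 a * chromaticTerm es (tail w) q f) (allFuns d n)) (allFin n)
    ≡⟨ sumMap-cong (λ a → *-sumMap (vertex0 a) (chromaticTerm es (tail w) q) (allFuns d n)) (allFin n) ⟨
  sumMap (λ a → vertex0 a * chromaticᴱ es (tail w) q n) (allFin n)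
    ≡⟨ sumMap-* vertex0 _ (allFin n) ⟨
  powerSum (head w) q n * chromaticᴱ es (tail w) q n ∎
  where
  vertex0 : Fin n → ℚ
  vertex0 a = q ^ℚ (head w ℕ.* suc (toℕ a))

  if-^ℚ-+ : ∀ b m k → (if b then q ^ℚ (m ℕ.+ k) else 0ℚ) ≡ q ^ℚ m * (if b then q ^ℚ k else 0ℚ)
  if-^ℚ-+ true  m k = ^ℚ-distribˡ-+-* q m k
  if-^ℚ-+ false m k = sym (ℚ.*-zeroʳ (q ^ℚ m))

  term-split : ∀ a f → chromaticTerm (map (mapEdge fsuc) es) w q (a Vector.∷ f)
                         ≡ vertex0 a * chromaticTerm es (tail w) q f
  term-split a f = trans
    (cong₂ (λ b m → if b then q ^ℚ m else 0ℚ) (isProperFor-map fsuc es (a Vector.∷ f)) (weight-∷ w a f))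
    (if-^ℚ-+ (isProperFor es f) (head w ℕ.* suc (toℕ a)) (weight (tail w) f))

[Λ]!χ : ∀ {d} → List (Edge d) → (Fin d → ℕ) → ℕ → ℚ → ℚ
[Λ]!χ es w n q = qfact q (total w) * chromaticᴱ es w q n

polyInQInt-[Λ]!χ-cong : ∀ {d} (es es′ : List (Edge d)) →
  (∀ {n} (c : Fin d → Fin n) → isProperFor es c ≡ isProperFor es′ c) →
  ∀ w → PolyInQInt ([Λ]!χ es w) → PolyInQInt ([Λ]!χ es′ w)
polyInQInt-[Λ]!χ-cong es es′ same w =
  polyInQInt-resp (λ n q → cong (qfact q (total w) *_) (chromaticᴱ-cong es es′ same w q n))

polyInQInt-[Λ]!χ-loop : ∀ {d} (u : Fin d) es w → PolyInQInt ([Λ]!χ ((u , u) ∷ es) w)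
polyInQInt-[Λ]!χ-loop u es w = polyInQInt-resp
  (λ n q → sym (trans (cong (qfact q (total w) *_) (chromaticᴱ-loop u es w q n))
                      (ℚ.*-zeroʳ (qfact q (total w)))))
  (polyInQInt-lift (polyInQ-const 0ℚ))

[Λ]!χ-deletion-contraction : ∀ {d} (w : Fin (suc d) → ℕ) k es n q →
  [Λ]!χ ((fzero , fsuc k) ∷ es) w n q
    ≡ [Λ]!χ es w n q - [Λ]!χ (map (mapEdge (contractVertex k)) es) (contractWeight w k) n q
[Λ]!χ-deletion-contraction w k es n q = begin
  F * χ ((fzero , fsuc k) ∷ es) w
    ≡⟨ cong (F *_) (chromaticᴱ-deletion-contraction k es w q n) ⟩
  F * (χ es w - χ es/k (contractWeight w k))
    ≡⟨ solve 3 (λ F A B → F :* (A :- B) := F :* A :- F :* B) refl F (χ es w) (χ es/k (contractWeight w k)) ⟩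
  F * χ es w - F * χ es/k (contractWeight w k)
    ≡⟨ cong (λ m → F * χ es w - qfact q m * χ es/k (contractWeight w k)) (total-contractWeight w k) ⟨
  [Λ]!χ es w n q - [Λ]!χ es/k (contractWeight w k) n q ∎
  where
  F : ℚ
  F = qfact q (total w)
  χ : ∀ {d} → List (Edge d) → (Fin d → ℕ) → ℚ
  χ es′ w′ = chromaticᴱ es′ w′ q n
  es/k : List (Edge _)
  es/k = map (mapEdge (contractVertex k)) es

polyInQInt-[Λ]!χ-isolated : ∀ {d} (w : Fin (suc d) → ℕ) → Positive w → ∀ es →
  PolyInQInt ([Λ]!χ es (tail w)) → PolyInQInt ([Λ]!χ (map (mapEdge fsuc) es) w)
polyInQInt-[Λ]!χ-isolated w w-pos es es-poly with qbinomial-isPoly (head w) (total (tail w))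
... | h , h-poly , split = polyInQInt-resp factor
  (polyInQInt-* (polyInQInt-lift h-poly) (polyInQInt-* (polyInQInt-qfact*powerSum (head w) (w-pos fzero)) es-poly))
  where
  factor : ∀ n q → h q * ((qfact q (head w) * powerSum (head w) q n) * [Λ]!χ es (tail w) n q)
                     ≡ [Λ]!χ (map (mapEdge fsuc) es) w n q
  factor n q = begin
    h q * ((F₀ * S) * (F * χ))
      ≡⟨ solve 5 (λ H F₀ S F χ → H :* ((F₀ :* S) :* (F :* χ)) := (H :* (F₀ :* F)) :* (S :* χ))
           refl (h q) F₀ S F χ ⟩
    (h q * (F₀ * F)) * (S * χ)
      ≡⟨ cong₂ _*_ (split q) (chromaticᴱ-isolated es w q n) ⟨
    qfact q (head w ℕ.+ total (tail w)) * chromaticᴱ (map (mapEdge fsuc) es) w q n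
      ≡⟨ cong (λ m → qfact q m * chromaticᴱ (map (mapEdge fsuc) es) w q n) (sum-allFin-suc w) ⟨
    [Λ]!χ (map (mapEdge fsuc) es) w n q ∎
    where
    F₀ S F χ : ℚ
    F₀ = qfact q (head w)
    S  = powerSum (head w) q n
    F  = qfact q (total (tail w))
    χ  = chromaticᴱ es (tail w) q n

mutual
  polyInQInt-[Λ]!χ : ∀ {d} (w : Fin d → ℕ) → Positive w → (es : List (Edge d)) → PolyInQInt ([Λ]!χ es w)
  polyInQInt-[Λ]!χ {zero}  w w-pos []             = polyInQInt-lift (polyInQ-const 1ℚ)
  polyInQInt-[Λ]!χ {zero}  w w-pos ((() , _) ∷ _)
  polyInQInt-[Λ]!χ {suc d} w w-pos es             =
    subst (λ es → PolyInQInt ([Λ]!χ es w)) (List.++-identityʳ es) (polyInQInt-[Λ]!χ-vertex0 w w-pos es [])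

  -- The edges in es are still to be examined at vertex 0; those in R are known to avoid it.
  polyInQInt-[Λ]!χ-vertex0 : ∀ {d} (w : Fin (suc d) → ℕ) → Positive w →
    (es : List (Edge (suc d))) (R : List (Edge d)) → PolyInQInt ([Λ]!χ (es ++ map (mapEdge fsuc) R) w)
  polyInQInt-[Λ]!χ-vertex0 w w-pos [] R =
    polyInQInt-[Λ]!χ-isolated w w-pos R (polyInQInt-[Λ]!χ (tail w) (w-pos ∘ fsuc) R)
  polyInQInt-[Λ]!χ-vertex0 w w-pos ((fzero , fzero) ∷ es) R =
    polyInQInt-[Λ]!χ-loop fzero (es ++ map (mapEdge fsuc) R) w
  polyInQInt-[Λ]!χ-vertex0 w w-pos ((fzero , fsuc k) ∷ es) R = polyInQInt-[Λ]!χ-edge0 w w-pos k es R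
  polyInQInt-[Λ]!χ-vertex0 w w-pos ((fsuc k , fzero) ∷ es) R =
    polyInQInt-[Λ]!χ-cong ((fzero , fsuc k) ∷ es′) ((fsuc k , fzero) ∷ es′)
      (isProperFor-swap (fsuc k) fzero es′) w (polyInQInt-[Λ]!χ-edge0 w w-pos k es R)
    where
    es′ : List (Edge _)
    es′ = es ++ map (mapEdge fsuc) R
  polyInQInt-[Λ]!χ-vertex0 w w-pos ((fsuc u , fsuc v) ∷ es) R =
    polyInQInt-[Λ]!χ-cong (es ++ map (mapEdge fsuc) ((u , v) ∷ R)) ((fsuc u , fsuc v) ∷ es ++ map (mapEdge fsuc) R)
      (λ c → sym (isProperFor-move (fsuc u , fsuc v) es (map (mapEdge fsuc) R) c)) w
      (polyInQInt-[Λ]!χ-vertex0 w w-pos es ((u , v) ∷ R))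

  polyInQInt-[Λ]!χ-edge0 : ∀ {d} (w : Fin (suc d) → ℕ) → Positive w →
    (k : Fin d) (es : List (Edge (suc d))) (R : List (Edge d)) →
    PolyInQInt ([Λ]!χ ((fzero , fsuc k) ∷ es ++ map (mapEdge fsuc) R) w)
  polyInQInt-[Λ]!χ-edge0 w w-pos k es R = polyInQInt-resp (λ n q → sym ([Λ]!χ-deletion-contraction w k es′ n q))
    (polyInQInt-- (polyInQInt-[Λ]!χ-vertex0 w w-pos es R)
                  (polyInQInt-[Λ]!χ (contractWeight w k) (contractWeight-positive w k w-pos)
                                    (map (mapEdge (contractVertex k)) es′)))
    where
    es′ : List (Edge _)
    es′ = es ++ map (mapEdge fsuc) R

edges : ∀ {d} → SimpleGraph d → List (Edge d)
edges {d} G = concatMap (λ i → concatMap (λ j → if adj G i j then (i , j) ∷ [] else []) (allFin d)) (allFin d)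

isProper≡isProperFor-edges : ∀ {d n} (G : SimpleGraph d) (c : Fin d → Fin n) →
  isProper G c ≡ isProperFor (edges G) c
isProper≡isProperFor-edges {d} G c = sym (trans (allᵇ-concatMap (separates c) _ (allFin d))
  (allᵇ-cong (λ i → trans (allᵇ-concatMap (separates c) _ (allFin d))
                          (allᵇ-cong (λ j → allᵇ-edge (adj G i j) i j) (allFin d)))
    (allFin d)))
  where
  allᵇ-edge : ∀ b i j → allᵇ (separates c) (if b then (i , j) ∷ [] else []) ≡ not b ∨ separates c (i , j)
  allᵇ-edge true  i j = Bool.∧-identityʳ (separates c (i , j))
  allᵇ-edge false i j = refl

chromatic≡chromaticᴱ-edges : ∀ {d} (G : SimpleGraph d) w q n → chromatic G w q n ≡ chromaticᴱ (edges G) w q n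
chromatic≡chromaticᴱ-edges {d} G w q n =
  trans (sumMap-filterᵇ (isProper G) (λ c → q ^ℚ weight w c) (allFuns d n))
        (sumMap-cong (λ c → cong (λ b → if b then q ^ℚ weight w c else 0ℚ) (isProper≡isProperFor-edges G c))
                     (allFuns d n))

-- The identity also holds for n = 0.
corollary7 : {d : ℕ} (G : SimpleGraph d) (λ' : Fin d → ℕ) →
    (∀ i → 1 ≤ λ' i) →
    ∃ λ (P : List Poly) → ∀ (n : ℕ) → 1 ≤ n → ∀ (q : ℚ) →
    evalPoly2 P q (qint q n) ≡ qfact q (total λ') * chromatic G λ' q n
corollary7 G w w-pos with polyInQInt-[Λ]!χ w w-pos (edges G)
... | P , P≗[Λ]!χ = P , λ n _ q →
  trans (P≗[Λ]!χ n q) (cong (qfact q (total w) *_) (sym (chromatic≡chromaticᴱ-edges G w q n)))
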